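{- Let $\vec c\in\mathbb{Z}^S$ with $0<c_i<p-1$ for all $i$, let $J\subseteq S$, and let $\vec a,\vec b\in\mathbb{Z}^S$ satisfy: $1\le a_i\le p$ for $i\in J$ and $a_i=0$ for $i\notin J$; $1\le b_i\le p$ for $i\notin J$ and $b_i=0$ for $i\in J$; $\sum_{i\in S}b_ip^i-\sum_{i\in S}a_ip^i\equiv\sum_{i\in S}c_ip^i\pmod{p^f-1}$. Then $a_i<p$ and $b_i<p$ for all $i$, unless either $\vec c=\vec1$, $J=\emptyset$ and $\vec b=\vec p$, or $\vec c=\overrightarrow{p-2}$, $J=S$ and $\vec a=\vec p$. In particular $\vec a$ and $\vec b$ are uniquely determined by $\vec c$ and $J$ except in these two cases, where one can also have $\vec b=\vec1$ (resp. $\vec a=\vec1$) instead of $\vec p$.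
   Context: $p$ is a prime, $f\ge1$, $S=\mathbb{Z}/f\mathbb{Z}$ with elements identified with $\{0,\dots,f-1\}$; $\vec n$ denotes the constant vector all of whose entries equal $n$. -}

module Defs where

open import Data.Nat using (ℕ; zero; suc; _^_)
open import Data.Integer using (ℤ; +_; _+_; _-_; _*_; _≤_; _<_; 0ℤ; 1ℤ)
open import Data.Integer.Divisibility using (_∣_)
open import Data.Fin using (Fin)
import Data.Fin as F
open import Data.Fin.Subset using (Subset; _∈_; _∉_)
open import Data.Product using (_×_)
open import Relation.Binary.PropositionalEquality using (_≡_)

-- Σ_{i ∈ Fin n} v i  (S = ℤ/fℤ identified with {0,…,f-1} = Fin f)
sumℤ : ∀ {n} → (Fin n → ℤ) → ℤ
sumℤ {zero}  v = 0ℤ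
sumℤ {suc n} v = v F.zero + sumℤ (λ i → v (F.suc i))

digitSum : (p : ℕ) {f : ℕ} → (Fin f → ℤ) → ℤ
digitSum p v = sumℤ (λ i → v i * (+ (p ^ F.toℕ i)))

const⃗ : ∀ {f} → ℤ → Fin f → ℤ
const⃗ n _ = n

_≗⃗_ : ∀ {f} → (Fin f → ℤ) → (Fin f → ℤ) → Set
u ≗⃗ v = ∀ i → u i ≡ v i

Sol : (p f : ℕ) → (c : Fin f → ℤ) → (J : Subset f) → (a b : Fin f → ℤ) → Set
Sol p f c J a b =
    (∀ i → i ∈ J → (1ℤ ≤ a i × a i ≤ + p))
  × (∀ i → i ∉ J → a i ≡ 0ℤ)
  × (∀ i → i ∉ J → (1ℤ ≤ b i × b i ≤ + p))
  × (∀ i → i ∈ J → b i ≡ 0ℤ)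
  × ((+ (p ^ f) - 1ℤ) ∣ ((digitSum p b - digitSum p a) - digitSum p c))

-- Index S = Fin f cyclically and let j_i = [i ∈ J]. The integers
-- e_i = b_i − a_i − c_i + p j_i − j_{i−1} satisfy Σ e_i p^i = Σ b_i p^i − Σ a_i p^i − Σ c_i p^i
-- + j_{f−1} (p^f − 1), since the terms p j_i − j_{i−1} telescope; hence p^f − 1 divides
-- Σ e_i p^i. The bounds on a, b, c give |e_i| ≤ p − 1, so |Σ e_i p^i| ≤ p^f − 1 and the sum is
-- 0 or ±(p^f − 1), which forces e to be constantly 0, p − 1 or −(p − 1). Digitwise,
-- e_i = b_i − (c_i + j_{i−1}) for i ∉ J and e_i = (p − c_i − j_{i−1}) − a_i for i ∈ J, with
-- 1 ≤ c_i + j_{i−1} ≤ p − 1: so e = 0 determines a and b and makes them < p, e = p − 1 is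
-- only possible with J = ∅, c = 1, b = p, and e = −(p − 1) only with J = S, c = p − 2, a = p.

{-# OPTIONS --safe #-}
module Submission where

open import Defs
open import Data.Nat using (ℕ; _≥_)
open import Data.Nat.Primality using (Prime)
open import Data.Integer using (ℤ; +_; _-_; _<_; 0ℤ; 1ℤ)
open import Data.Fin using (Fin)
open import Data.Fin.Subset using (Subset; ⊥; ⊤)
open import Data.Product using (_×_)
open import Data.Sum using (_⊎_)
open import Relation.Binary.PropositionalEquality using (_≡_)

open import Data.Nat as ℕ using (zero; suc; _^_; z≤n; s≤s)
import Data.Nat.Properties as ℕ
open import Data.Integer.Base
  using (_+_; _*_; -_; _≤_; -1ℤ; +≤+; +<+; -≤-; -<-; +0; +[1+_]; -[1+_]; NonNegative; Positive; positive)
  renaming (suc to sucℤ)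
open import Data.Integer.Properties
open import Data.Integer.Divisibility.Signed using (_∣_; module _∣_; ∣ᵤ⇒∣; ∣-refl; ∣m∣n⇒∣m+n; ∣n⇒∣m*n)
open import Data.Integer.Tactic.RingSolver using (solve-∀)
open import Data.Fin using (zero; suc; toℕ; inject₁; fromℕ)
open import Data.Fin.Properties using (toℕ-inject₁; toℕ-fromℕ)
open import Data.Fin.Subset using (_∈_; _∉_)
open import Data.Fin.Subset.Properties using (_∈?_; ∈⊤; ∉⊥; ⊆-antisym; ⊆⊤; Empty-unique)
open import Data.Bool using (true; false; if_then_else_)
open import Data.Vec using (lookup)
open import Data.Vec.Properties using ([]=⇒lookup; lookup⇒[]=)
open import Data.Empty using (⊥-elim)
open import Data.Product using (_,_; proj₁; proj₂)
import Data.Product as Product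
open import Data.Sum using (inj₁; inj₂)
import Data.Sum as Sum
open import Relation.Nullary using (yes; no; contradiction)
open import Relation.Binary.PropositionalEquality
  using (_≢_; refl; sym; trans; cong; cong₂; subst; subst₂; module ≡-Reasoning)
open import Algebra.Properties.Semiring.Sum +-*-semiring
  using (sum; sum-cong-≗; ∑-distrib-+; *-distribˡ-sum; sum-init-last)
open import Algebra.Properties.CommutativeSemigroup *-commutativeSemigroup using (x∙yz≈y∙xz)
open import Algebra.Properties.AbelianGroup +-0-abelianGroup using (inverseˡ-unique; inverseʳ-unique)

infix 4 _∈[_,_]
_∈[_,_] : ℤ → ℤ → ℤ → Set
x ∈[ l , u ] = l ≤ x × x ≤ u

+-mono-≤-tight : ∀ {x x′ y y′} → x ≤ x′ → y ≤ y′ → x + y ≡ x′ + y′ → x ≡ x′ × y ≡ y′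
+-mono-≤-tight x≤x′ y≤y′ eq =
  ≤-antisym x≤x′ (≮⇒≥ λ x<x′ → <-irrefl eq (+-mono-<-≤ x<x′ y≤y′)) ,
  ≤-antisym y≤y′ (≮⇒≥ λ y<y′ → <-irrefl eq (+-mono-≤-< x≤x′ y<y′))

-1<i<1⇒i≡0 : ∀ {i} → -1ℤ < i → i < 1ℤ → i ≡ 0ℤ
-1<i<1⇒i≡0 {+0}       _         _               = refl
-1<i<1⇒i≡0 {+[1+ _ ]} _         (+<+ (s≤s ()))
-1<i<1⇒i≡0 { -[1+ _ ]} (-<- ()) _

-1≤i≤1⇒i≡0∨1∨-1 : ∀ {i} → -1ℤ ≤ i → i ≤ 1ℤ → i ≡ 0ℤ ⊎ i ≡ 1ℤ ⊎ i ≡ -1ℤ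
-1≤i≤1⇒i≡0∨1∨-1 {+0}             _              _              = inj₁ refl
-1≤i≤1⇒i≡0∨1∨-1 {+[1+ zero ]}    _              _              = inj₂ (inj₁ refl)
-1≤i≤1⇒i≡0∨1∨-1 {+[1+ suc _ ]}   _              (+≤+ (s≤s ()))
-1≤i≤1⇒i≡0∨1∨-1 { -[1+ zero ]}   _              _              = inj₂ (inj₂ refl)
-1≤i≤1⇒i≡0∨1∨-1 { -[1+ suc _ ]}  (-≤- ())       _

k*-1≡-k : ∀ k → k * -1ℤ ≡ - k
k*-1≡-k k = trans (*-comm k -1ℤ) (-1*i≡-i k)

-k<k*q<k⇒q≡0 : ∀ k q .{{_ : NonNegative k}} → - k < k * q → k * q < k → q ≡ 0ℤ
-k<k*q<k⇒q≡0 k q lo hi = -1<i<1⇒i≡0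
  (*-cancelˡ-<-nonNeg k (subst (_< k * q) (sym (k*-1≡-k k)) lo))
  (*-cancelˡ-<-nonNeg k (subst (k * q <_) (sym (*-identityʳ k)) hi))

-k≤k*q≤k⇒k*q≡0∨k∨-k : ∀ k q .{{_ : Positive k}} → - k ≤ k * q → k * q ≤ k →
                       k * q ≡ 0ℤ ⊎ k * q ≡ k ⊎ k * q ≡ - k
-k≤k*q≤k⇒k*q≡0∨k∨-k k q lo hi with -1≤i≤1⇒i≡0∨1∨-1
  (*-cancelˡ-≤-pos -1ℤ q k (subst (_≤ k * q) (sym (k*-1≡-k k)) lo))
  (*-cancelˡ-≤-pos q 1ℤ k (subst (k * q ≤_) (sym (*-identityʳ k)) hi))
... | inj₁ refl        = inj₁ (*-zeroʳ k)
... | inj₂ (inj₁ refl) = inj₂ (inj₁ (*-identityʳ k))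
... | inj₂ (inj₂ refl) = inj₂ (inj₂ (k*-1≡-k k))

sumℤ≡sum : ∀ {n} (v : Fin n → ℤ) → sumℤ v ≡ sum v
sumℤ≡sum {zero}  v = refl
sumℤ≡sum {suc n} v = cong (_+_ (v zero)) (sumℤ≡sum (λ i → v (suc i)))

cyclicPred : ∀ {n} → Fin (suc n) → Fin (suc n)
cyclicPred {n} zero = fromℕ n
cyclicPred (suc i)  = inject₁ i

0<m-1 : ∀ {m} → 1 ℕ.< m → 0ℤ < + m - 1ℤ
0<m-1 (s≤s (s≤s _)) = +<+ (s≤s z≤n)

module _ {p : ℕ} where

  private
    w : ∀ {n} → Fin n → ℤ
    w i = + (p ^ toℕ i)

  digitSum≡∑ : ∀ {n} (v : Fin n → ℤ) → digitSum p v ≡ sum (λ i → v i * w i)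
  digitSum≡∑ v = sumℤ≡sum (λ i → v i * w i)

  digitSum-cong : ∀ {n} {u v : Fin n → ℤ} → (∀ i → u i ≡ v i) → digitSum p u ≡ digitSum p v
  digitSum-cong {u = u} {v} u≗v = begin
    digitSum p u           ≡⟨ digitSum≡∑ u ⟩
    sum (λ i → u i * w i)  ≡⟨ sum-cong-≗ (λ i → cong (_* w i) (u≗v i)) ⟩
    sum (λ i → v i * w i)  ≡⟨ digitSum≡∑ v ⟨
    digitSum p v           ∎
    where open ≡-Reasoning

  digitSum-+ : ∀ {n} (u v : Fin n → ℤ) →
               digitSum p (λ i → u i + v i) ≡ digitSum p u + digitSum p v
  digitSum-+ u v = begin
    digitSum p (λ i → u i + v i)                   ≡⟨ digitSum≡∑ (λ i → u i + v i) ⟩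
    sum (λ i → (u i + v i) * w i)                  ≡⟨ sum-cong-≗ (λ i → *-distribʳ-+ (w i) (u i) (v i)) ⟩
    sum (λ i → u i * w i + v i * w i)              ≡⟨ ∑-distrib-+ (λ i → u i * w i) (λ i → v i * w i) ⟩
    sum (λ i → u i * w i) + sum (λ i → v i * w i)  ≡⟨ cong₂ _+_ (digitSum≡∑ u) (digitSum≡∑ v) ⟨
    digitSum p u + digitSum p v                    ∎
    where open ≡-Reasoning

  digitSum-*ˡ : ∀ {n} k (v : Fin n → ℤ) → digitSum p (λ i → k * v i) ≡ k * digitSum p v
  digitSum-*ˡ k v = begin
    digitSum p (λ i → k * v i)   ≡⟨ digitSum≡∑ (λ i → k * v i) ⟩
    sum (λ i → k * v i * w i)    ≡⟨ sum-cong-≗ (λ i → *-assoc k (v i) (w i)) ⟩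
    sum (λ i → k * (v i * w i))  ≡⟨ *-distribˡ-sum k (λ i → v i * w i) ⟨
    k * sum (λ i → v i * w i)    ≡⟨ cong (k *_) (digitSum≡∑ v) ⟨
    k * digitSum p v             ∎
    where open ≡-Reasoning

  digitSum-neg : ∀ {n} (v : Fin n → ℤ) → digitSum p (λ i → - v i) ≡ - digitSum p v
  digitSum-neg v = begin
    digitSum p (λ i → - v i)       ≡⟨ digitSum-cong (λ i → -1*i≡-i (v i)) ⟨
    digitSum p (λ i → -1ℤ * v i)   ≡⟨ digitSum-*ˡ -1ℤ v ⟩
    -1ℤ * digitSum p v             ≡⟨ -1*i≡-i (digitSum p v) ⟩
    - digitSum p v                 ∎
    where open ≡-Reasoning

  digitSum-sub : ∀ {n} (u v : Fin n → ℤ) →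
               digitSum p (λ i → u i - v i) ≡ digitSum p u - digitSum p v
  digitSum-sub u v = trans (digitSum-+ u (λ i → - v i)) (cong (_+_ (digitSum p u)) (digitSum-neg v))

  digitSum-horner : ∀ {n} (v : Fin (suc n) → ℤ) →
                    digitSum p v ≡ v zero + + p * digitSum p (λ i → v (suc i))
  digitSum-horner v = begin
    digitSum p v
      ≡⟨ digitSum≡∑ v ⟩
    v zero * 1ℤ + sum (λ i → v (suc i) * w (suc i))
      ≡⟨ cong₂ _+_ (*-identityʳ (v zero)) (sum-cong-≗ shift) ⟩
    v zero + sum (λ i → + p * (v (suc i) * w i))
      ≡⟨ cong (_+_ (v zero)) (*-distribˡ-sum (+ p) (λ i → v (suc i) * w i)) ⟨
    v zero + + p * sum (λ i → v (suc i) * w i)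
      ≡⟨ cong (λ s → v zero + + p * s) (digitSum≡∑ (λ i → v (suc i))) ⟨
    v zero + + p * digitSum p (λ i → v (suc i))
      ∎
    where
    open ≡-Reasoning
    shift : ∀ i → v (suc i) * w (suc i) ≡ + p * (v (suc i) * w i)
    shift i = trans (cong (v (suc i) *_) (pos-* p (p ^ toℕ i))) (x∙yz≈y∙xz (v (suc i)) (+ p) (w i))

  digitSum-init-last : ∀ {n} (v : Fin (suc n) → ℤ) →
                       digitSum p v ≡ digitSum p (λ i → v (inject₁ i)) + v (fromℕ n) * + (p ^ n)
  digitSum-init-last {n} v = begin
    digitSum p v
      ≡⟨ digitSum≡∑ v ⟩
    sum (λ i → v i * w i)
      ≡⟨ sum-init-last (λ i → v i * w i) ⟩
    sum (λ i → v (inject₁ i) * w (inject₁ i)) + v (fromℕ n) * w (fromℕ n)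
      ≡⟨ cong₂ _+_ (sum-cong-≗ (λ i → cong (λ k → v (inject₁ i) * + (p ^ k)) (toℕ-inject₁ i)))
                   (cong (λ k → v (fromℕ n) * + (p ^ k)) (toℕ-fromℕ n)) ⟩
    sum (λ i → v (inject₁ i) * w i) + v (fromℕ n) * + (p ^ n)
      ≡⟨ cong (_+ v (fromℕ n) * + (p ^ n)) (digitSum≡∑ (λ i → v (inject₁ i))) ⟨
    digitSum p (λ i → v (inject₁ i)) + v (fromℕ n) * + (p ^ n)
      ∎
    where open ≡-Reasoning

  digitSum-const : ∀ n → digitSum p {n} (const⃗ (+ p - 1ℤ)) ≡ + (p ^ n) - 1ℤ
  digitSum-const zero    = refl
  digitSum-const (suc n) = begin
    digitSum p {suc n} (const⃗ (+ p - 1ℤ))                ≡⟨ digitSum-horner {n} (const⃗ (+ p - 1ℤ)) ⟩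
    (+ p - 1ℤ) + + p * digitSum p {n} (const⃗ (+ p - 1ℤ))  ≡⟨ cong (λ s → (+ p - 1ℤ) + + p * s) (digitSum-const n) ⟩
    (+ p - 1ℤ) + + p * (+ (p ^ n) - 1ℤ)                   ≡⟨ geometric (+ p) (+ (p ^ n)) ⟩
    + p * + (p ^ n) - 1ℤ                                  ≡⟨ cong (_- 1ℤ) (pos-* p (p ^ n)) ⟨
    + (p ^ suc n) - 1ℤ                                    ∎
    where
    open ≡-Reasoning
    geometric : ∀ P X → (P - 1ℤ) + P * (X - 1ℤ) ≡ P * X - 1ℤ
    geometric = solve-∀

  digitSum-mono-≤ : ∀ {n} {u v : Fin n → ℤ} → (∀ i → u i ≤ v i) → digitSum p u ≤ digitSum p v
  digitSum-mono-≤ {zero}          u≤v = ≤-refl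
  digitSum-mono-≤ {suc n} {u} {v} u≤v = begin
    digitSum p u                                ≡⟨ digitSum-horner u ⟩
    u zero + + p * digitSum p (λ i → u (suc i)) ≤⟨ +-mono-≤ (u≤v zero) (*-monoˡ-≤-nonNeg (+ p) (digitSum-mono-≤ (λ i → u≤v (suc i)))) ⟩
    v zero + + p * digitSum p (λ i → v (suc i)) ≡⟨ digitSum-horner v ⟨
    digitSum p v                                ∎
    where open ≤-Reasoning

  digitSum-mono-≤-tight : ∀ {n} .{{_ : ℕ.NonZero p}} {u v : Fin n → ℤ} → (∀ i → u i ≤ v i) →
                          digitSum p u ≡ digitSum p v → ∀ i → u i ≡ v i
  digitSum-mono-≤-tight {suc n} {u} {v} u≤v eq = λ where
      zero    → proj₁ split
      (suc i) → digitSum-mono-≤-tight (λ i → u≤v (suc i)) (*-cancelˡ-≡ (+ p) _ _ (proj₂ split)) i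
    where
    split : u zero ≡ v zero × + p * digitSum p (λ i → u (suc i)) ≡ + p * digitSum p (λ i → v (suc i))
    split = +-mono-≤-tight (u≤v zero) (*-monoˡ-≤-nonNeg (+ p) (digitSum-mono-≤ (λ i → u≤v (suc i))))
                           (trans (sym (digitSum-horner u)) (trans eq (digitSum-horner v)))

  digitSum≡0⇒≡0 : ∀ {n} {e : Fin n → ℤ} → (∀ i → - + p < e i) → (∀ i → e i < + p) →
                  digitSum p e ≡ 0ℤ → ∀ i → e i ≡ 0ℤ
  digitSum≡0⇒≡0 {suc n} {e} lo hi eq = λ where
      zero    → e₀≡0
      (suc i) → digitSum≡0⇒≡0 (λ i → lo (suc i)) (λ i → hi (suc i)) tail≡0 i
    where
    tail : ℤ
    tail = digitSum p (λ i → e (suc i))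
    horner : e zero + + p * tail ≡ 0ℤ
    horner = trans (sym (digitSum-horner e)) eq
    p*tail≡-e₀ : + p * tail ≡ - e zero
    p*tail≡-e₀ = inverseʳ-unique (e zero) (+ p * tail) horner
    tail≡0 : tail ≡ 0ℤ
    tail≡0 = -k<k*q<k⇒q≡0 (+ p) tail
      (subst (- + p <_) (sym p*tail≡-e₀) (neg-mono-< (hi zero)))
      (subst₂ _<_ (sym p*tail≡-e₀) (neg-involutive (+ p)) (neg-mono-< (lo zero)))
    e₀≡0 : e zero ≡ 0ℤ
    e₀≡0 = begin
      e zero           ≡⟨ inverseˡ-unique (e zero) (+ p * tail) horner ⟩
      - (+ p * tail)   ≡⟨ cong (λ t → - (+ p * t)) tail≡0 ⟩
      - (+ p * 0ℤ)     ≡⟨ cong -_ (*-zeroʳ (+ p)) ⟩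
      0ℤ               ∎
      where open ≡-Reasoning

  digitSum-carries : ∀ {n} (g : Fin (suc n) → ℤ) →
                     digitSum p (λ i → + p * g i - g (cyclicPred i)) ≡ g (fromℕ n) * (+ (p ^ suc n) - 1ℤ)
  digitSum-carries {n} g = begin
    digitSum p (λ i → + p * g i - g (cyclicPred i))
      ≡⟨ digitSum-sub (λ i → + p * g i) (λ i → g (cyclicPred i)) ⟩
    digitSum p (λ i → + p * g i) - digitSum p (λ i → g (cyclicPred i))
      ≡⟨ cong₂ _-_ (trans (digitSum-*ˡ (+ p) g) (cong (+ p *_) (digitSum-init-last g)))
                   (digitSum-horner (λ i → g (cyclicPred i))) ⟩
    + p * (I + gₙ * + (p ^ n)) - (gₙ + + p * I)
      ≡⟨ telescope (+ p) I gₙ (+ (p ^ n)) ⟩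
    gₙ * (+ p * + (p ^ n) - 1ℤ)
      ≡⟨ cong (λ x → gₙ * (x - 1ℤ)) (pos-* p (p ^ n)) ⟨
    gₙ * (+ (p ^ suc n) - 1ℤ)
      ∎
    where
    open ≡-Reasoning
    gₙ I : ℤ
    gₙ = g (fromℕ n)
    I  = digitSum p (λ i → g (inject₁ i))
    telescope : ∀ P I g X → P * (I + g * X) - (g + P * I) ≡ g * (P * X - 1ℤ)
    telescope = solve-∀

  pᶠ-1∣digitSum⇒constant : ∀ {n} → 1 ℕ.< p → (e : Fin (suc n) → ℤ) →
    (∀ i → e i ∈[ - (+ p - 1ℤ) , + p - 1ℤ ]) → (+ (p ^ suc n) - 1ℤ) ∣ digitSum p e →
    (∀ i → e i ≡ 0ℤ) ⊎ (∀ i → e i ≡ + p - 1ℤ) ⊎ (∀ i → e i ≡ - (+ p - 1ℤ))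
  pᶠ-1∣digitSum⇒constant {n} 1<p e bounds N∣D =
    Sum.map all-zero (Sum.map all-max all-min) D≡0∨N∨-N
    where
    M N D : ℤ
    M = + p - 1ℤ
    N = + (p ^ suc n) - 1ℤ
    D = digitSum p e

    q : ℤ
    q = _∣_.quotient N∣D
    D≡Nq : D ≡ N * q
    D≡Nq = trans (_∣_.equality N∣D) (*-comm q N)

    0<N : 0ℤ < N
    0<N = 0<m-1 (ℕ.^-monoʳ-< p 1<p {0} {suc n} (s≤s z≤n))
    D[-M]≡-N : digitSum p (const⃗ {suc n} (- M)) ≡ - N
    D[-M]≡-N = trans (digitSum-neg (const⃗ {suc n} M)) (cong -_ (digitSum-const (suc n)))
    D≤N : D ≤ N
    D≤N = subst (D ≤_) (digitSum-const (suc n)) (digitSum-mono-≤ (λ i → proj₂ (bounds i)))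
    -N≤D : - N ≤ D
    -N≤D = subst (_≤ D) D[-M]≡-N (digitSum-mono-≤ (λ i → proj₁ (bounds i)))
    D≡0∨N∨-N : D ≡ 0ℤ ⊎ D ≡ N ⊎ D ≡ - N
    D≡0∨N∨-N = subst (λ x → x ≡ 0ℤ ⊎ x ≡ N ⊎ x ≡ - N) (sym D≡Nq)
      (-k≤k*q≤k⇒k*q≡0∨k∨-k N q {{positive 0<N}} (subst (- N ≤_) D≡Nq -N≤D) (subst (_≤ N) D≡Nq D≤N))

    M<p : M < + p
    M<p = m⊖1+n<m p 1
    all-zero : D ≡ 0ℤ → ∀ i → e i ≡ 0ℤ
    all-zero = digitSum≡0⇒≡0 (λ i → <-≤-trans (neg-mono-< M<p) (proj₁ (bounds i)))
                             (λ i → ≤-<-trans (proj₂ (bounds i)) M<p)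
    all-max : D ≡ N → ∀ i → e i ≡ M
    all-max D≡N = digitSum-mono-≤-tight {{ℕ.>-nonZero (ℕ.<-trans (s≤s z≤n) 1<p)}}
      (λ i → proj₂ (bounds i)) (trans D≡N (sym (digitSum-const (suc n))))
    all-min : D ≡ - N → ∀ i → e i ≡ - M
    all-min D≡-N i = sym (digitSum-mono-≤-tight {{ℕ.>-nonZero (ℕ.<-trans (s≤s z≤n) 1<p)}}
      (λ i → proj₁ (bounds i)) (trans D[-M]≡-N (sym D≡-N)) i)

𝟙 : ∀ {n} → Subset n → Fin n → ℤ
𝟙 J i = if lookup J i then 1ℤ else 0ℤ

𝟙-∈ : ∀ {n} {J : Subset n} {i} → i ∈ J → 𝟙 J i ≡ 1ℤ
𝟙-∈ i∈J = cong (if_then 1ℤ else 0ℤ) ([]=⇒lookup i∈J)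

𝟙-∉ : ∀ {n} {J : Subset n} {i} → i ∉ J → 𝟙 J i ≡ 0ℤ
𝟙-∉ {J = J} {i} i∉J with lookup J i in J[i]
... | true  = contradiction (lookup⇒[]= i J J[i]) i∉J
... | false = refl

𝟙-∈[0,1] : ∀ {n} (J : Subset n) i → 𝟙 J i ∈[ 0ℤ , 1ℤ ]
𝟙-∈[0,1] J i with lookup J i
... | true  = +≤+ z≤n , ≤-refl
... | false = ≤-refl , +≤+ z≤n

x-y∈[2-P,P-1] : ∀ {P x y : ℤ} → x ∈[ 1ℤ , P ] → y ∈[ 1ℤ , P - 1ℤ ] → x - y ∈[ sucℤ (- (P - 1ℤ)) , P - 1ℤ ]
x-y∈[2-P,P-1] (1≤x , x≤P) (1≤y , y≤P-1) = +-mono-≤ 1≤x (neg-mono-≤ y≤P-1) , +-mono-≤ x≤P (neg-mono-≤ 1≤y)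

x-y≡P-1⇒x≡P∧y≡1 : ∀ {P x y : ℤ} → x ≤ P → 1ℤ ≤ y → x - y ≡ P - 1ℤ → x ≡ P × y ≡ 1ℤ
x-y≡P-1⇒x≡P∧y≡1 x≤P 1≤y eq = Product.map₂ neg-injective (+-mono-≤-tight x≤P (neg-mono-≤ 1≤y) eq)

P-t∈[1,P-1] : ∀ {P t : ℤ} → t ∈[ 1ℤ , P - 1ℤ ] → P - t ∈[ 1ℤ , P - 1ℤ ]
P-t∈[1,P-1] {P} (1≤t , t≤P-1) =
  subst (_≤ P - _) (P-[P-1]≡1 P) (+-monoʳ-≤ P (neg-mono-≤ t≤P-1)) , +-monoʳ-≤ P (neg-mono-≤ 1≤t)
  where
  P-[P-1]≡1 : ∀ P → P - (P - 1ℤ) ≡ 1ℤ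
  P-[P-1]≡1 = solve-∀

∈[1-k,k]⇒≢-k : ∀ {k x : ℤ} → x ∈[ sucℤ (- k) , k ] → x ≢ - k
∈[1-k,k]⇒≢-k (1-k≤x , _) refl = <-irrefl refl (suc[i]≤j⇒i<j 1-k≤x)

∈[1-k,k]⇒∈[-k,k] : ∀ {k x : ℤ} → x ∈[ sucℤ (- k) , k ] → x ∈[ - k , k ]
∈[1-k,k]⇒∈[-k,k] {k} = Product.map₁ (≤-trans (i≤suc[i] (- k)))

neg-∈[-k,k] : ∀ {k x : ℤ} → x ∈[ - k , k ] → - x ∈[ - k , k ]
neg-∈[-k,k] {k} (-k≤x , x≤k) = neg-mono-≤ x≤k , subst (- _ ≤_) (neg-involutive k) (neg-mono-≤ -k≤x)

module Classification (p : ℕ) {n : ℕ} (c : Fin (suc n) → ℤ)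
                      (0<c<p-1 : ∀ i → 0ℤ < c i × c i < + p - 1ℤ) (J : Subset (suc n)) where

  c∈[1,p-2] : ∀ i → c i ∈[ 1ℤ , + p - + 2 ]
  c∈[1,p-2] i = i<j⇒suc[i]≤j (proj₁ (0<c<p-1 i)) ,
                subst (c i ≤_) (pred[P-1]≡P-2 (+ p)) (i<j⇒i≤pred[j] (proj₂ (0<c<p-1 i)))
    where
    pred[P-1]≡P-2 : ∀ P → -1ℤ + (P - 1ℤ) ≡ P - + 2
    pred[P-1]≡P-2 = solve-∀

  1<p : 1 ℕ.< p
  1<p = ℕ.<⇒≤ (drop‿+≤+ (begin
    + 3               ≤⟨ +-monoˡ-≤ (+ 2) (≤-trans (proj₁ (c∈[1,p-2] zero)) (proj₂ (c∈[1,p-2] zero))) ⟩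
    (+ p - + 2) + + 2 ≡⟨ P-2+2≡P (+ p) ⟩
    + p               ∎))
    where
    open ≤-Reasoning
    P-2+2≡P : ∀ P → (P - + 2) + + 2 ≡ P
    P-2+2≡P = solve-∀

  0<p : 0ℤ < + p
  0<p = +<+ (ℕ.<-trans (s≤s z≤n) 1<p)

  carry : Fin (suc n) → ℤ
  carry i = 𝟙 J (cyclicPred i)

  c+carry : Fin (suc n) → ℤ
  c+carry i = c i + carry i

  c+carry∈[1,p-1] : ∀ i → c+carry i ∈[ 1ℤ , + p - 1ℤ ]
  c+carry∈[1,p-1] i =
    +-mono-≤ (proj₁ (c∈[1,p-2] i)) (proj₁ (𝟙-∈[0,1] J (cyclicPred i))) ,
    subst (c+carry i ≤_) (P-2+1≡P-1 (+ p)) (+-mono-≤ (proj₂ (c∈[1,p-2] i)) (proj₂ (𝟙-∈[0,1] J (cyclicPred i))))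
    where
    P-2+1≡P-1 : ∀ P → (P - + 2) + 1ℤ ≡ P - 1ℤ
    P-2+1≡P-1 = solve-∀

  c+carry≡1⇒c≡1 : ∀ i → c+carry i ≡ 1ℤ → c i ≡ 1ℤ
  c+carry≡1⇒c≡1 i eq =
    sym (proj₁ (+-mono-≤-tight (proj₁ (c∈[1,p-2] i)) (proj₁ (𝟙-∈[0,1] J (cyclicPred i))) (sym eq)))

  c+carry≡p-1⇒c≡p-2 : ∀ i → c+carry i ≡ + p - 1ℤ → c i ≡ + p - + 2
  c+carry≡p-1⇒c≡p-2 i eq =
    proj₁ (+-mono-≤-tight (proj₂ (c∈[1,p-2] i)) (proj₂ (𝟙-∈[0,1] J (cyclicPred i)))
                          (trans eq (P-1≡P-2+1 (+ p))))
    where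
    P-1≡P-2+1 : ∀ P → P - 1ℤ ≡ (P - + 2) + 1ℤ
    P-1≡P-2+1 = solve-∀

  Generic : (a b : Fin (suc n) → ℤ) → Set
  Generic a b = (∀ i → i ∉ J → b i ≡ c+carry i) × (∀ i → i ∈ J → a i ≡ + p - c+carry i)

  Exceptional⊥ : (b : Fin (suc n) → ℤ) → Set
  Exceptional⊥ b = (c ≗⃗ const⃗ 1ℤ) × J ≡ ⊥ × (b ≗⃗ const⃗ (+ p))

  Exceptional⊤ : (a : Fin (suc n) → ℤ) → Set
  Exceptional⊤ a = (c ≗⃗ const⃗ (+ p - + 2)) × J ≡ ⊤ × (a ≗⃗ const⃗ (+ p))

  Ambiguous⊥ : (b b′ : Fin (suc n) → ℤ) → Set
  Ambiguous⊥ b b′ = (c ≗⃗ const⃗ 1ℤ) × J ≡ ⊥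
                  × (b ≗⃗ const⃗ 1ℤ ⊎ b ≗⃗ const⃗ (+ p)) × (b′ ≗⃗ const⃗ 1ℤ ⊎ b′ ≗⃗ const⃗ (+ p))

  Ambiguous⊤ : (a a′ : Fin (suc n) → ℤ) → Set
  Ambiguous⊤ a a′ = (c ≗⃗ const⃗ (+ p - + 2)) × J ≡ ⊤
                  × (a ≗⃗ const⃗ 1ℤ ⊎ a ≗⃗ const⃗ (+ p)) × (a′ ≗⃗ const⃗ 1ℤ ⊎ a′ ≗⃗ const⃗ (+ p))

  module Solution {a b : Fin (suc n) → ℤ} (sol : Sol p (suc n) c J a b) where

    a∈[1,p] : ∀ i → i ∈ J → a i ∈[ 1ℤ , + p ]
    a∈[1,p] = proj₁ sol
    a≡0 : ∀ i → i ∉ J → a i ≡ 0ℤ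
    a≡0 = proj₁ (proj₂ sol)
    b∈[1,p] : ∀ i → i ∉ J → b i ∈[ 1ℤ , + p ]
    b∈[1,p] = proj₁ (proj₂ (proj₂ sol))
    b≡0 : ∀ i → i ∈ J → b i ≡ 0ℤ
    b≡0 = proj₁ (proj₂ (proj₂ (proj₂ sol)))

    e : Fin (suc n) → ℤ
    e i = ((b i - a i) - c i) + (+ p * 𝟙 J i - carry i)

    e-∉ : ∀ {i} → i ∉ J → e i ≡ b i - c+carry i
    e-∉ {i} i∉J = begin
      e i                                        ≡⟨ cong₂ (λ x j → ((b i - x) - c i) + (+ p * j - carry i)) (a≡0 i i∉J) (𝟙-∉ i∉J) ⟩
      ((b i - 0ℤ) - c i) + (+ p * 0ℤ - carry i)  ≡⟨ outside (+ p) (b i) (c i) (carry i) ⟩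
      b i - c+carry i                            ∎
      where
      open ≡-Reasoning
      outside : ∀ P b c k → ((b - 0ℤ) - c) + (P * 0ℤ - k) ≡ b - (c + k)
      outside = solve-∀

    e-∈ : ∀ {i} → i ∈ J → e i ≡ - (a i - (+ p - c+carry i))
    e-∈ {i} i∈J = begin
      e i                                        ≡⟨ cong₂ (λ x j → ((x - a i) - c i) + (+ p * j - carry i)) (b≡0 i i∈J) (𝟙-∈ i∈J) ⟩
      ((0ℤ - a i) - c i) + (+ p * 1ℤ - carry i)  ≡⟨ inside (+ p) (a i) (c i) (carry i) ⟩
      - (a i - (+ p - c+carry i))                ∎
      where
      open ≡-Reasoning
      inside : ∀ P a c k → ((0ℤ - a) - c) + (P * 1ℤ - k) ≡ - (a - (P - (c + k)))
      inside = solve-∀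

    b-c+carry∈ : ∀ {i} → i ∉ J → b i - c+carry i ∈[ sucℤ (- (+ p - 1ℤ)) , + p - 1ℤ ]
    b-c+carry∈ {i} i∉J = x-y∈[2-P,P-1] (b∈[1,p] i i∉J) (c+carry∈[1,p-1] i)

    a-[p-c+carry]∈ : ∀ {i} → i ∈ J → a i - (+ p - c+carry i) ∈[ sucℤ (- (+ p - 1ℤ)) , + p - 1ℤ ]
    a-[p-c+carry]∈ {i} i∈J = x-y∈[2-P,P-1] (a∈[1,p] i i∈J) (P-t∈[1,P-1] {+ p} (c+carry∈[1,p-1] i))

    e∈[1-p,p-1] : ∀ i → e i ∈[ - (+ p - 1ℤ) , + p - 1ℤ ]
    e∈[1-p,p-1] i with i ∈? J
    ... | yes i∈J = subst (_∈[ - (+ p - 1ℤ) , + p - 1ℤ ]) (sym (e-∈ i∈J))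
                          (neg-∈[-k,k] (∈[1-k,k]⇒∈[-k,k] (a-[p-c+carry]∈ i∈J)))
    ... | no  i∉J = subst (_∈[ - (+ p - 1ℤ) , + p - 1ℤ ]) (sym (e-∉ i∉J))
                          (∈[1-k,k]⇒∈[-k,k] (b-c+carry∈ i∉J))

    pᶠ-1∣digitSum-e : (+ (p ^ suc n) - 1ℤ) ∣ digitSum p e
    pᶠ-1∣digitSum-e = subst (+ (p ^ suc n) - 1ℤ ∣_) (sym digitSum-e)
      (∣m∣n⇒∣m+n (∣ᵤ⇒∣ {i = X} (proj₂ (proj₂ (proj₂ (proj₂ sol))))) (∣n⇒∣m*n (𝟙 J (fromℕ n)) ∣-refl))
      where
      X : ℤ
      X = (digitSum p b - digitSum p a) - digitSum p c
      digitSum-e : digitSum p e ≡ X + 𝟙 J (fromℕ n) * (+ (p ^ suc n) - 1ℤ)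
      digitSum-e = trans (digitSum-+ {p} (λ i → (b i - a i) - c i) (λ i → + p * 𝟙 J i - carry i))
        (cong₂ _+_ (trans (digitSum-sub {p} (λ i → b i - a i) c) (cong (_- digitSum p c) (digitSum-sub {p} b a)))
                   (digitSum-carries {p} (𝟙 J)))

    classify : Generic a b ⊎ Exceptional⊥ b ⊎ Exceptional⊤ a
    classify = Sum.map generic (Sum.map exceptional⊥ exceptional⊤)
                 (pᶠ-1∣digitSum⇒constant 1<p e e∈[1-p,p-1] pᶠ-1∣digitSum-e)
      where
      generic : (∀ i → e i ≡ 0ℤ) → Generic a b
      generic e≡0 =
        (λ i i∉J → i-j≡0⇒i≡j (b i) _ (trans (sym (e-∉ i∉J)) (e≡0 i))) ,
        (λ i i∈J → i-j≡0⇒i≡j (a i) _ (neg-injective (trans (sym (e-∈ i∈J)) (e≡0 i))))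

      exceptional⊥ : (∀ i → e i ≡ + p - 1ℤ) → Exceptional⊥ b
      exceptional⊥ e≡p-1 = (λ i → proj₂ (proj₂ (digit i))) ,
                           Empty-unique (λ (i , i∈J) → proj₁ (digit i) i∈J) ,
                           (λ i → proj₁ (proj₂ (digit i)))
        where
        digit : ∀ i → i ∉ J × b i ≡ + p × c i ≡ 1ℤ
        digit i with i ∈? J
        ... | yes i∈J = contradiction
          (trans (sym (neg-involutive _)) (cong -_ (trans (sym (e-∈ i∈J)) (e≡p-1 i))))
          (∈[1-k,k]⇒≢-k (a-[p-c+carry]∈ i∈J))
        ... | no  i∉J = i∉J , Product.map₂ (c+carry≡1⇒c≡1 i)
          (x-y≡P-1⇒x≡P∧y≡1 (proj₂ (b∈[1,p] i i∉J)) (proj₁ (c+carry∈[1,p-1] i))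
                           (trans (sym (e-∉ i∉J)) (e≡p-1 i)))

      exceptional⊤ : (∀ i → e i ≡ - (+ p - 1ℤ)) → Exceptional⊤ a
      exceptional⊤ e≡1-p = (λ i → proj₂ (proj₂ (digit i))) ,
                           ⊆-antisym ⊆⊤ (λ {i} _ → proj₁ (digit i)) ,
                           (λ i → proj₁ (proj₂ (digit i)))
        where
        digit : ∀ i → i ∈ J × a i ≡ + p × c i ≡ + p - + 2
        digit i with i ∈? J
        ... | no  i∉J = contradiction (trans (sym (e-∉ i∉J)) (e≡1-p i))
                                      (∈[1-k,k]⇒≢-k (b-c+carry∈ i∉J))
        ... | yes i∈J = i∈J , Product.map₂ p-c+carry≡1⇒c≡p-2
          (x-y≡P-1⇒x≡P∧y≡1 (proj₂ (a∈[1,p] i i∈J)) (proj₁ (P-t∈[1,P-1] {+ p} (c+carry∈[1,p-1] i)))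
                           (neg-injective (trans (sym (e-∈ i∈J)) (e≡1-p i))))
          where
          P-[P-t]≡t : ∀ P t → t ≡ P - (P - t)
          P-[P-t]≡t = solve-∀
          p-c+carry≡1⇒c≡p-2 : + p - c+carry i ≡ 1ℤ → c i ≡ + p - + 2
          p-c+carry≡1⇒c≡p-2 eq = c+carry≡p-1⇒c≡p-2 i (trans (P-[P-t]≡t (+ p) _) (cong (_-_ (+ p)) eq))

  open Solution public using (classify)
  open Solution using (a≡0; b≡0)

  generic⇒<p : ∀ {a b} → Sol p (suc n) c J a b → Generic a b → ∀ i → a i < + p × b i < + p
  generic⇒<p sol (b≡c+carry , a≡p-c+carry) i with i ∈? J
  ... | yes i∈J = subst (_< + p) (sym (a≡p-c+carry i i∈J))
                        (≤-<-trans (proj₂ (P-t∈[1,P-1] {+ p} (c+carry∈[1,p-1] i))) (m⊖1+n<m p 1)) ,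
                  subst (_< + p) (sym (b≡0 sol i i∈J)) 0<p
  ... | no  i∉J = subst (_< + p) (sym (a≡0 sol i i∉J)) 0<p ,
                  subst (_< + p) (sym (b≡c+carry i i∉J)) (≤-<-trans (proj₂ (c+carry∈[1,p-1] i)) (m⊖1+n<m p 1))

  generic-unique : ∀ {a b a′ b′} → Sol p (suc n) c J a b → Sol p (suc n) c J a′ b′ →
                   Generic a b → Generic a′ b′ → a ≗⃗ a′ × b ≗⃗ b′
  generic-unique {a} {b} {a′} {b′} sol sol′ (b≡ , a≡) (b′≡ , a′≡) =
    (λ i → proj₁ (at i)) , (λ i → proj₂ (at i))
    where
    at : ∀ i → a i ≡ a′ i × b i ≡ b′ i
    at i with i ∈? J
    ... | yes i∈J = trans (a≡ i i∈J) (sym (a′≡ i i∈J)) , trans (b≡0 sol i i∈J) (sym (b≡0 sol′ i i∈J))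
    ... | no  i∉J = trans (a≡0 sol i i∉J) (sym (a≡0 sol′ i i∉J)) , trans (b≡ i i∉J) (sym (b′≡ i i∉J))

  J≡⊥⇒J≢⊤ : J ≡ ⊥ → J ≢ ⊤
  J≡⊥⇒J≢⊤ J≡⊥ J≡⊤ = ∉⊥ (subst (zero ∈_) (trans (sym J≡⊤) J≡⊥) ∈⊤)

  exceptional⊥-values : ∀ {a b} → c ≗⃗ const⃗ 1ℤ → J ≡ ⊥ → Sol p (suc n) c J a b →
                        b ≗⃗ const⃗ 1ℤ ⊎ b ≗⃗ const⃗ (+ p)
  exceptional⊥-values {a} {b} c≡1 J≡⊥ sol = values (classify sol)
    where
    ∉J : ∀ i → i ∉ J
    ∉J i = subst (i ∉_) (sym J≡⊥) ∉⊥
    values : Generic a b ⊎ Exceptional⊥ b ⊎ Exceptional⊤ a → b ≗⃗ const⃗ 1ℤ ⊎ b ≗⃗ const⃗ (+ p)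
    values (inj₁ (b≡c+carry , _))      = inj₁ λ i →
      trans (b≡c+carry i (∉J i)) (cong₂ _+_ (c≡1 i) (𝟙-∉ (∉J (cyclicPred i))))
    values (inj₂ (inj₁ (_ , _ , b≡p))) = inj₂ b≡p
    values (inj₂ (inj₂ (_ , J≡⊤ , _))) = ⊥-elim (J≡⊥⇒J≢⊤ J≡⊥ J≡⊤)

  exceptional⊤-values : ∀ {a b} → c ≗⃗ const⃗ (+ p - + 2) → J ≡ ⊤ → Sol p (suc n) c J a b →
                        a ≗⃗ const⃗ 1ℤ ⊎ a ≗⃗ const⃗ (+ p)
  exceptional⊤-values {a} {b} c≡p-2 J≡⊤ sol = values (classify sol)
    where
    ∈J : ∀ i → i ∈ J
    ∈J i = subst (i ∈_) (sym J≡⊤) ∈⊤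
    P-[[P-2]+1]≡1 : ∀ P → P - ((P - + 2) + 1ℤ) ≡ 1ℤ
    P-[[P-2]+1]≡1 = solve-∀
    values : Generic a b ⊎ Exceptional⊥ b ⊎ Exceptional⊤ a → a ≗⃗ const⃗ 1ℤ ⊎ a ≗⃗ const⃗ (+ p)
    values (inj₁ (_ , a≡p-c+carry))    = inj₁ λ i →
      trans (a≡p-c+carry i (∈J i))
            (trans (cong₂ (λ x k → + p - (x + k)) (c≡p-2 i) (𝟙-∈ (∈J (cyclicPred i)))) (P-[[P-2]+1]≡1 (+ p)))
    values (inj₂ (inj₁ (_ , J≡⊥ , _))) = ⊥-elim (J≡⊥⇒J≢⊤ J≡⊥ J≡⊤)
    values (inj₂ (inj₂ (_ , _ , a≡p))) = inj₂ a≡p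

  ambiguous⊥ : ∀ {a b a′ b′} → c ≗⃗ const⃗ 1ℤ → J ≡ ⊥ →
               Sol p (suc n) c J a b → Sol p (suc n) c J a′ b′ → Ambiguous⊥ b b′
  ambiguous⊥ c≡1 J≡⊥ sol sol′ =
    c≡1 , J≡⊥ , exceptional⊥-values c≡1 J≡⊥ sol , exceptional⊥-values c≡1 J≡⊥ sol′

  ambiguous⊤ : ∀ {a b a′ b′} → c ≗⃗ const⃗ (+ p - + 2) → J ≡ ⊤ →
               Sol p (suc n) c J a b → Sol p (suc n) c J a′ b′ → Ambiguous⊤ a a′
  ambiguous⊤ c≡p-2 J≡⊤ sol sol′ =
    c≡p-2 , J≡⊤ , exceptional⊤-values c≡p-2 J≡⊤ sol , exceptional⊤-values c≡p-2 J≡⊤ sol′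

  uniqueness : ∀ {a b a′ b′} → Sol p (suc n) c J a b → Sol p (suc n) c J a′ b′ →
               Generic a b ⊎ Exceptional⊥ b ⊎ Exceptional⊤ a →
               Generic a′ b′ ⊎ Exceptional⊥ b′ ⊎ Exceptional⊤ a′ →
               (a ≗⃗ a′ × b ≗⃗ b′) ⊎ Ambiguous⊥ b b′ ⊎ Ambiguous⊤ a a′
  uniqueness sol sol′ (inj₁ g) (inj₁ g′)                       = inj₁ (generic-unique sol sol′ g g′)
  uniqueness sol sol′ (inj₂ (inj₁ (c≡1 , J≡⊥ , _))) _           = inj₂ (inj₁ (ambiguous⊥ c≡1 J≡⊥ sol sol′))
  uniqueness sol sol′ (inj₁ _) (inj₂ (inj₁ (c≡1 , J≡⊥ , _)))    = inj₂ (inj₁ (ambiguous⊥ c≡1 J≡⊥ sol sol′))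
  uniqueness sol sol′ (inj₂ (inj₂ (c≡p-2 , J≡⊤ , _))) _         = inj₂ (inj₂ (ambiguous⊤ c≡p-2 J≡⊤ sol sol′))
  uniqueness sol sol′ (inj₁ _) (inj₂ (inj₂ (c≡p-2 , J≡⊤ , _)))  = inj₂ (inj₂ (ambiguous⊤ c≡p-2 J≡⊤ sol sol′))

lemma7p5 : (p f : ℕ) → Prime p → f ≥ 1 →
    (c : Fin f → ℤ) → (∀ i → (0ℤ < c i × c i < + p - 1ℤ)) →
    (J : Subset f) →
    -- main claim: all entries < p, unless one of the two exceptional cases
    ((a b : Fin f → ℤ) → Sol p f c J a b →
        ((∀ i → (a i < + p × b i < + p))
        ⊎ ((c ≗⃗ const⃗ 1ℤ) × J ≡ ⊥ × (b ≗⃗ const⃗ (+ p)))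
        ⊎ ((c ≗⃗ const⃗ (+ p - + 2)) × J ≡ ⊤ × (a ≗⃗ const⃗ (+ p)))))
    ×
    -- in particular: uniqueness of (a⃗, b⃗), except in the two cases where
    -- b⃗ (resp. a⃗) may be either 1⃗ or p⃗
    ((a b a' b' : Fin f → ℤ) → Sol p f c J a b → Sol p f c J a' b' →
        ((a ≗⃗ a' × b ≗⃗ b')
        ⊎ ((c ≗⃗ const⃗ 1ℤ) × J ≡ ⊥
            × (b ≗⃗ const⃗ 1ℤ ⊎ b ≗⃗ const⃗ (+ p))
            × (b' ≗⃗ const⃗ 1ℤ ⊎ b' ≗⃗ const⃗ (+ p)))
        ⊎ ((c ≗⃗ const⃗ (+ p - + 2)) × J ≡ ⊤
            × (a ≗⃗ const⃗ 1ℤ ⊎ a ≗⃗ const⃗ (+ p))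
            × (a' ≗⃗ const⃗ 1ℤ ⊎ a' ≗⃗ const⃗ (+ p)))))
lemma7p5 p zero    _ () _ _ _
lemma7p5 p (suc n) _ _  c 0<c<p-1 J =
  (λ a b sol → Sum.map₁ (generic⇒<p sol) (classify sol)) ,
  (λ a b a′ b′ sol sol′ → uniqueness sol sol′ (classify sol) (classify sol′))
  where open Classification p c 0<c<p-1 J
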